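{- Let $p$ be an odd prime, $l$ an even residue class modulo $p-1$, and $r$ a positive integer. Then there exist coefficients $a^{(r)}_m(p,l)\in\mathbb{Q}_p$, $m=0,1,2,\ldots$, such that for every even integer $k\ge4$ with $k\equiv l\pmod{p-1}$ there is a convergent $p$-adic series identity $$a_r(G^*_k)=\sum_{m=0}^{\infty}a^{(r)}_m(p,l)\,k^m,$$ and the coefficients satisfy: (1) $v_p(a^{(r)}_m(p,l))\ge m-\frac{m}{p-1}$ for all $m$, $p$, $l$; (2) $v_p(a^{(r)}_m(p,l))\ge m$ whenever $p\ge m+2$ (for all $l$).
   Context: For an odd prime $p$, an even integer $k\ge4$ and a positive integer $r$, $a_r(G^*_k)=\sum_{d\mid r,\ p\nmid d}d^{k-1}$ (the $r$-th $q$-expansion coefficient of Serre's $p$-adic Eisenstein series of weight $k$). $v_p$ denotes the $p$-adic valuation on $\mathbb{Q}_p$. -}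

module Defs where

open import Data.Nat as ℕ using (ℕ; zero; suc; _∸_; _/_; _⊓_)
open import Data.Nat.Divisibility using (_∣?_)
open import Data.Integer as ℤ using (ℤ; +_; _-_)
open import Data.Integer.Divisibility using (_∣_)
open import Data.List using (List; filter; map; applyUpTo)
open import Data.Nat.ListAction using (sum)
open import Relation.Nullary using (¬?)
open import Relation.Nullary.Decidable using (_×-dec_)

aG* : (p k r : ℕ) → ℕ
aG* p k r = sum (map (λ d → d ℕ.^ (k ∸ 1))
                     (filter (λ d → (d ∣? r) ×-dec ¬? (p ∣? d)) (applyUpTo suc r)))

-- The p-adic integers ℤ_p as the inverse limit lim ℤ/p^n:
-- a coherent sequence of integer representatives x n of residues mod p^n.
record ℤ[_] (p : ℕ) : Set where
  field
    approx   : ℕ → ℤ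
    coherent : ∀ n → (+ (p ℕ.^ n)) ∣ (approx (suc n) - approx n)
open ℤ[_] public

vp≥ : {p : ℕ} → ℤ[ p ] → ℕ → Set
vp≥ {p} x t = ∀ n → (+ (p ℕ.^ (n ℕ.⊓ t))) ∣ approx x n

partialSum : {p : ℕ} → (ℕ → ℤ[ p ]) → ℕ → ℕ → ℕ → ℤ
partialSum a k n zero    = + 0
partialSum a k n (suc M) = partialSum a k n M ℤ.+ approx (a M) n ℤ.* (+ (k ℕ.^ M))

SeriesConvergesTo : {p : ℕ} → (ℕ → ℤ[ p ]) → ℕ → ℕ → Set
SeriesConvergesTo {p} a k N =
  ∀ n → Data.Product.∃ λ M₀ → ∀ M → M₀ ℕ.≤ M →
    (+ (p ℕ.^ n)) ∣ (partialSum a k n M - + N)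
  where import Data.Product

-- ⌈m - m/(p-1)⌉ = m ∸ ⌊m/(p-1)⌋  (for p ≥ 3; the case p ≤ 2 never arises, set to m)
vbound : (p m : ℕ) → ℕ
vbound (suc (suc (suc q))) m = m ∸ (m / suc (suc q))
vbound _ m = m

module Submission where

-- Write k = L + (p - 1) j with 1 ≤ L and L ≡ l.  For p ∤ d, Fermat gives d^(p-1) = 1 + p e, so
-- Newton's forward-difference formula writes a_r(G*_k) = Σ_d d^(L-1) (1 + p e)^j as Σ_i C(j,i) Δ_i
-- with p^i ∣ Δ_i.  Now i! (p-1)^i C(j,i) = ∏_{t<i} (k - L - (p-1) t) is a polynomial in k, and
-- expanding these Newton basis polynomials turns the sum into a power series in k whose m-th
-- coefficient is Σ_{i≥m} Δ_i / (i! (p-1)^i) · [k^m] ∏_{t<i} (k - L - (p-1) t).  By Legendre,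
-- (p-1) v_p(i!) ≤ i, so the i-th term has valuation ≥ i - i/(p-1), which is nondecreasing in i:
-- this gives bound (1), and bound (2) is its case m < p - 1.  The same estimate (≥ i/2) shows that
-- modulo p^n only the terms i < 2n matter, so every coefficient is a genuine p-adic integer.

open import Algebra.Bundles using (CommutativeSemiring)
open import Data.Nat as ℕ using (ℕ; zero; suc; _≤_; _<_; z≤n; s≤s)
import Data.Nat.Properties as ℕP
import Data.Nat.Divisibility as ℕ
open import Data.Nat.Primality using (Prime; euclidsLemma; ¬prime[1]; prime⇒nonZero; prime⇒nonTrivial)
open import Data.Integer as ℤ using (ℤ)
import Data.Integer.Properties as ℤP
open import Data.List using (List; []; _∷_; map)
open import Data.Nat.ListAction using (sum)
open import Data.List.Relation.Unary.All as All using (All; []; _∷_)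
open import Data.Product using (Σ; ∃; _,_; _×_; proj₁; proj₂)
open import Data.Sum using (inj₁; inj₂)
open import Data.Empty using (⊥-elim)
open import Relation.Nullary using (¬_; yes; no)
open import Relation.Binary.PropositionalEquality as ≡ using (_≡_)
open import Defs using (ℤ[_]; approx; coherent; vp≥; partialSum; SeriesConvergesTo)

module FiniteSum {c ℓ} (R : CommutativeSemiring c ℓ) where

  open CommutativeSemiring R
  open import Relation.Binary.Reasoning.Setoid setoid
  open import Algebra.Properties.CommutativeSemigroup +-commutativeSemigroup using (interchange)

  ∑ : ℕ → (ℕ → Carrier) → Carrier
  ∑ zero    f = 0#
  ∑ (suc N) f = ∑ N f + f N

  ∑-cong : ∀ N {f g} → (∀ i → i < N → f i ≈ g i) → ∑ N f ≈ ∑ N g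
  ∑-cong zero    f≈g = refl
  ∑-cong (suc N) f≈g = +-cong (∑-cong N (λ i i<N → f≈g i (ℕP.m<n⇒m<1+n i<N))) (f≈g N ℕP.≤-refl)

  ∑-suc : ∀ N f → ∑ (suc N) f ≈ f 0 + ∑ N (λ i → f (suc i))
  ∑-suc zero    f = +-comm 0# (f 0)
  ∑-suc (suc N) f = begin
    ∑ (suc N) f + f (suc N)                    ≈⟨ +-congʳ (∑-suc N f) ⟩
    f 0 + ∑ N (λ i → f (suc i)) + f (suc N)    ≈⟨ +-assoc (f 0) _ _ ⟩
    f 0 + (∑ N (λ i → f (suc i)) + f (suc N))  ∎

  ∑-+ : ∀ N f g → ∑ N (λ i → f i + g i) ≈ ∑ N f + ∑ N g
  ∑-+ zero    f g = sym (+-identityˡ 0#)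
  ∑-+ (suc N) f g = begin
    ∑ N (λ i → f i + g i) + (f N + g N)  ≈⟨ +-congʳ (∑-+ N f g) ⟩
    ∑ N f + ∑ N g + (f N + g N)          ≈⟨ interchange (∑ N f) (∑ N g) (f N) (g N) ⟩
    ∑ N f + f N + (∑ N g + g N)          ∎

  ∑-*ˡ : ∀ N x f → x * ∑ N f ≈ ∑ N (λ i → x * f i)
  ∑-*ˡ zero    x f = zeroʳ x
  ∑-*ˡ (suc N) x f = trans (distribˡ x (∑ N f) (f N)) (+-congʳ (∑-*ˡ N x f))

  ∑-*ʳ : ∀ N x f → ∑ N f * x ≈ ∑ N (λ i → f i * x)
  ∑-*ʳ N x f = begin
    ∑ N f * x              ≈⟨ *-comm (∑ N f) x ⟩
    x * ∑ N f              ≈⟨ ∑-*ˡ N x f ⟩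
    ∑ N (λ i → x * f i)    ≈⟨ ∑-cong N (λ i _ → *-comm x (f i)) ⟩
    ∑ N (λ i → f i * x)    ∎

  ∑-zero : ∀ N {f} → (∀ i → i < N → f i ≈ 0#) → ∑ N f ≈ 0#
  ∑-zero N {f} f≈0 = trans (∑-cong N f≈0) (∑-0 N)
    where
    ∑-0 : ∀ N → ∑ N (λ _ → 0#) ≈ 0#
    ∑-0 zero    = refl
    ∑-0 (suc N) = trans (+-identityʳ _) (∑-0 N)

  ∑-+-split : ∀ a b f → ∑ (a ℕ.+ b) f ≈ ∑ a f + ∑ b (λ t → f (a ℕ.+ t))
  ∑-+-split a zero    f = begin
    ∑ (a ℕ.+ 0) f  ≡⟨ ≡.cong (λ n → ∑ n f) (ℕP.+-identityʳ a) ⟩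
    ∑ a f          ≈⟨ sym (+-identityʳ (∑ a f)) ⟩
    ∑ a f + 0#     ∎
  ∑-+-split a (suc b) f = begin
    ∑ (a ℕ.+ suc b) f                                ≡⟨ ≡.cong (λ n → ∑ n f) (ℕP.+-suc a b) ⟩
    ∑ (a ℕ.+ b) f + f (a ℕ.+ b)                      ≈⟨ +-congʳ (∑-+-split a b f) ⟩
    ∑ a f + ∑ b (λ t → f (a ℕ.+ t)) + f (a ℕ.+ b)    ≈⟨ +-assoc (∑ a f) _ _ ⟩
    ∑ a f + (∑ b (λ t → f (a ℕ.+ t)) + f (a ℕ.+ b))  ∎

  ∑-comm : ∀ M N (g : ℕ → ℕ → Carrier) → ∑ M (λ m → ∑ N (λ i → g i m)) ≈ ∑ N (λ i → ∑ M (g i))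
  ∑-comm zero    N g = sym (∑-zero N (λ _ _ → refl))
  ∑-comm (suc M) N g = begin
    ∑ M (λ m → ∑ N (λ i → g i m)) + ∑ N (λ i → g i M)  ≈⟨ +-congʳ (∑-comm M N g) ⟩
    ∑ N (λ i → ∑ M (g i)) + ∑ N (λ i → g i M)          ≈⟨ sym (∑-+ N (λ i → ∑ M (g i)) (λ i → g i M)) ⟩
    ∑ N (λ i → ∑ (suc M) (g i))                          ∎

  ∑-closed : ∀ {p} (P : Carrier → Set p) → P 0# → (∀ {x y} → P x → P y → P (x + y)) →
             ∀ N {f} → (∀ i → i < N → P (f i)) → P (∑ N f)
  ∑-closed P P0 P+ zero    Pf = P0
  ∑-closed P P0 P+ (suc N) Pf = P+ (∑-closed P P0 P+ N (λ i i<N → Pf i (ℕP.m<n⇒m<1+n i<N))) (Pf N ℕP.≤-refl)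

module ℕ∑ = FiniteSum ℕP.+-*-commutativeSemiring
module ℤ∑ = FiniteSum ℤP.+-*-commutativeSemiring

open ≡ using (refl; cong; cong₂; sym; trans)

-- Arithmetic of Legendre's bound

module _ where
  open import Data.Nat using (_+_; _*_; _∸_)
  open import Data.Nat.DivMod using (_/_; m*n/n≡m; /-monoˡ-≤; m/n≡1+[m∸n]/n)
  open ℕP.≤-Reasoning

  n*E≤a⇒n*[a+E]≤a*[1+n]+b : ∀ {n a E} b → n * E ≤ a → n * (a + E) ≤ a * suc n + b
  n*E≤a⇒n*[a+E]≤a*[1+n]+b {n} {a} {E} b n*E≤a = begin
    n * (a + E)      ≡⟨ ℕP.*-distribˡ-+ n a E ⟩
    n * a + n * E    ≤⟨ ℕP.+-monoʳ-≤ (n * a) n*E≤a ⟩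
    n * a + a        ≡⟨ cong (_+ a) (ℕP.*-comm n a) ⟩
    a * n + a        ≡⟨ ℕP.+-comm (a * n) a ⟩
    a + a * n        ≡⟨ ℕP.*-suc a n ⟨
    a * suc n        ≤⟨ ℕP.m≤m+n (a * suc n) b ⟩
    a * suc n + b    ∎

  2≤n⇒n*E≤i⇒2*t≤i⇒t≤i∸E : ∀ {n E i t} → 2 ≤ n → n * E ≤ i → 2 * t ≤ i → t ≤ i ∸ E
  2≤n⇒n*E≤i⇒2*t≤i⇒t≤i∸E {n} {E} {i} {t} 2≤n n*E≤i 2*t≤i = ℕP.m+n≤o⇒m≤o∸n t (ℕP.*-cancelˡ-≤ 2 (begin
    2 * (t + E)      ≡⟨ ℕP.*-distribˡ-+ 2 t E ⟩
    2 * t + 2 * E    ≤⟨ ℕP.+-mono-≤ 2*t≤i (ℕP.≤-trans (ℕP.*-monoˡ-≤ E 2≤n) n*E≤i) ⟩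
    i + i            ≡⟨ cong (i +_) (ℕP.+-identityʳ i) ⟨
    2 * i            ∎))

  module _ {n} .{{_ : ℕ.NonZero n}} where

    n*E≤i⇒E≤i/n : ∀ {E i} → n * E ≤ i → E ≤ i / n
    n*E≤i⇒E≤i/n {E} {i} n*E≤i = begin
      E          ≡⟨ m*n/n≡m E n ⟨
      E * n / n  ≤⟨ /-monoˡ-≤ n (ℕP.≤-trans (ℕP.≤-reflexive (ℕP.*-comm E n)) n*E≤i) ⟩
      i / n      ∎

    m∸m/n≤[1+m]∸[1+m]/n : ∀ m → m ∸ m / n ≤ suc m ∸ suc m / n
    m∸m/n≤[1+m]∸[1+m]/n m = ℕP.∸-monoʳ-≤ (suc m) (begin
      suc m / n              ≤⟨ /-monoˡ-≤ n (ℕP.m<m+n m (ℕ.>-nonZero⁻¹ n)) ⟩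
      (m + n) / n            ≡⟨ m/n≡1+[m∸n]/n (ℕP.m≤n+m n m) ⟩
      suc ((m + n ∸ n) / n)  ≡⟨ cong (λ x → suc (x / n)) (ℕP.m+n∸n≡m m n) ⟩
      suc (m / n)            ∎)

    m∸m/n-mono : ∀ {m i} → m ≤ i → m ∸ m / n ≤ i ∸ i / n
    m∸m/n-mono m≤i = go (ℕP.≤⇒≤′ m≤i)
      where
      go : ∀ {m i} → m ℕ.≤′ i → m ∸ m / n ≤ i ∸ i / n
      go ℕ.≤′-refl        = ℕP.≤-refl
      go (ℕ.≤′-step m≤′i) = ℕP.≤-trans (go m≤′i) (m∸m/n≤[1+m]∸[1+m]/n _)

    m≤i⇒n*E≤i⇒m∸m/n≤i∸E : ∀ {m i E} → m ≤ i → n * E ≤ i → m ∸ m / n ≤ i ∸ E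
    m≤i⇒n*E≤i⇒m∸m/n≤i∸E {i = i} m≤i n*E≤i =
      ℕP.≤-trans (m∸m/n-mono m≤i) (ℕP.∸-monoʳ-≤ i (n*E≤i⇒E≤i/n n*E≤i))

-- Binomial coefficients, Fermat and Legendre

module _ where
  open import Data.Nat using (_+_; _*_; _∸_; _^_; _!)
  open import Data.Nat.DivMod using (_/_; _%_; m≡m%n+[m/n]*n; m%n<n; m/n<m)
  open import Data.Nat.Divisibility
    using ( _∣_; divides; ∣-refl; *-pres-∣; ∣⇒≤; ∣1⇒≡1; _∣0; ∣m⇒∣m*n; ∣n⇒∣m*n; ∣m∣n⇒∣m+n
          ; n∣m*n; ∣m+n∣m⇒∣n)
  open import Data.Nat.Combinatorics using (_C_; nCk+nC[k+1]≡[n+1]C[k+1]; nCn≡1)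
  open import Data.Nat.Combinatorics.Base using (_P′_)
  open import Data.Nat.Induction using (<-rec)
  open import Data.Nat.Tactic.RingSolver using (solve-∀)
  open import Algebra.Properties.CommutativeSemigroup ℕP.*-commutativeSemigroup using (x∙yz≈y∙xz)
  open ≡.≡-Reasoning

  ^-monoʳ-∣ : ∀ p {m n} → m ≤ n → p ^ m ∣ p ^ n
  ^-monoʳ-∣ p {m} {n} m≤n = divides (p ^ (n ∸ m)) (begin
    p ^ n                ≡⟨ cong (p ^_) (ℕP.m∸n+n≡m m≤n) ⟨
    p ^ (n ∸ m + m)      ≡⟨ ℕP.^-distribˡ-+-* p (n ∸ m) m ⟩
    p ^ (n ∸ m) * p ^ m  ∎)

  m∣n⇒m^k∣n^k : ∀ {m n} k → m ∣ n → m ^ k ∣ n ^ k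
  m∣n⇒m^k∣n^k zero    m∣n = ∣-refl
  m∣n⇒m^k∣n^k (suc k) m∣n = *-pres-∣ m∣n (m∣n⇒m^k∣n^k k m∣n)

  n<k⇒nP′k≡0 : ∀ {n k} → n < k → (n P′ k) ≡ 0
  n<k⇒nP′k≡0 {n} {suc k} (s≤s n≤k) with ℕP.m≤n⇒m<n∨m≡n n≤k
  ... | inj₁ n<k  = trans (cong ((n ∸ k) *_) (n<k⇒nP′k≡0 n<k)) (ℕP.*-zeroʳ (n ∸ k))
  ... | inj₂ refl = cong (_* (n P′ n)) (ℕP.n∸n≡0 n)

  nP′[1+k]≡n*[n∸1]P′k : ∀ n k → (n P′ suc k) ≡ n * ((n ∸ 1) P′ k)
  nP′[1+k]≡n*[n∸1]P′k zero    k       = cong (_* (0 P′ k)) (ℕP.0∸n≡0 k)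
  nP′[1+k]≡n*[n∸1]P′k (suc n) zero    = refl
  nP′[1+k]≡n*[n∸1]P′k (suc n) (suc k) = begin
    (n ∸ k) * (suc n P′ suc k)    ≡⟨ cong ((n ∸ k) *_) (nP′[1+k]≡n*[n∸1]P′k (suc n) k) ⟩
    (n ∸ k) * (suc n * (n P′ k))  ≡⟨ x∙yz≈y∙xz (n ∸ k) (suc n) (n P′ k) ⟩
    suc n * ((n ∸ k) * (n P′ k))  ∎

  k!*nCk≡nP′k : ∀ n k → k ! * (n C k) ≡ (n P′ k)
  k!*nCk≡nP′k n       zero    = refl
  k!*nCk≡nP′k zero    (suc k) = trans (ℕP.*-zeroʳ (suc k !)) (sym (n<k⇒nP′k≡0 {0} {suc k} (s≤s z≤n)))
  k!*nCk≡nP′k (suc n) (suc k) = begin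
    suc k ! * (suc n C suc k)                        ≡⟨ cong (suc k ! *_) (nCk+nC[k+1]≡[n+1]C[k+1] n k) ⟨
    suc k * k ! * ((n C k) + (n C suc k))            ≡⟨ distrib (suc k) (k !) (n C k) (n C suc k) ⟩
    suc k * (k ! * (n C k)) + suc k ! * (n C suc k)  ≡⟨ cong₂ (λ a b → suc k * a + b) (k!*nCk≡nP′k n k) (k!*nCk≡nP′k n (suc k)) ⟩
    suc k * (n P′ k) + (n ∸ k) * (n P′ k)            ≡⟨ ℕP.*-distribʳ-+ (n P′ k) (suc k) (n ∸ k) ⟨
    (suc k + (n ∸ k)) * (n P′ k)                     ≡⟨ collapse ⟩
    suc n * (n P′ k)                                 ≡⟨ nP′[1+k]≡n*[n∸1]P′k (suc n) k ⟨
    (suc n P′ suc k)                                 ∎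
    where
    distrib : ∀ a b c d → a * b * (c + d) ≡ a * (b * c) + a * b * d
    distrib = solve-∀
    collapse : (suc k + (n ∸ k)) * (n P′ k) ≡ suc n * (n P′ k)
    collapse with k ℕP.≤? n
    ... | yes k≤n = cong (λ m → suc m * (n P′ k)) (ℕP.m+[n∸m]≡n k≤n)
    ... | no  k≰n rewrite n<k⇒nP′k≡0 (ℕP.≰⇒> k≰n) = trans (ℕP.*-zeroʳ (suc k + (n ∸ k))) (sym (ℕP.*-zeroʳ (suc n)))

  binomial-theorem : ∀ j x N → j < N → ℕ∑.∑ N (λ i → (j C i) * x ^ i) ≡ suc x ^ j
  binomial-theorem zero    x (suc N) _ = begin
    ℕ∑.∑ (suc N) (λ i → (0 C i) * x ^ i)   ≡⟨ ℕ∑.∑-suc N _ ⟩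
    1 + ℕ∑.∑ N (λ _ → 0)                   ≡⟨ cong (1 +_) (ℕ∑.∑-zero N (λ _ _ → refl)) ⟩
    1                                      ∎
  binomial-theorem (suc j) x (suc N) (s≤s j<N) = begin
    ℕ∑.∑ (suc N) (λ i → (suc j C i) * x ^ i)
      ≡⟨ ℕ∑.∑-suc N _ ⟩
    1 + ℕ∑.∑ N (λ i → (suc j C suc i) * x ^ suc i)
      ≡⟨ cong (1 +_) (ℕ∑.∑-cong N (λ i _ → pascal i)) ⟩
    1 + ℕ∑.∑ N (λ i → x * ((j C i) * x ^ i) + (j C suc i) * x ^ suc i)
      ≡⟨ cong (1 +_) (ℕ∑.∑-+ N _ _) ⟩
    1 + (ℕ∑.∑ N (λ i → x * ((j C i) * x ^ i)) + S₊)
      ≡⟨ cong (λ s → 1 + (s + S₊)) (ℕ∑.∑-*ˡ N x _) ⟨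
    1 + (x * ℕ∑.∑ N (λ i → (j C i) * x ^ i) + S₊)
      ≡⟨ rearrange 1 (x * ℕ∑.∑ N (λ i → (j C i) * x ^ i)) S₊ ⟩
    (1 + S₊) + x * ℕ∑.∑ N (λ i → (j C i) * x ^ i)
      ≡⟨ cong₂ (λ a b → a + x * b) (sym (ℕ∑.∑-suc N (λ i → (j C i) * x ^ i))) (binomial-theorem j x N j<N) ⟩
    ℕ∑.∑ (suc N) (λ i → (j C i) * x ^ i) + x * suc x ^ j
      ≡⟨ cong (_+ x * suc x ^ j) (binomial-theorem j x (suc N) (ℕP.m<n⇒m<1+n j<N)) ⟩
    suc x ^ j + x * suc x ^ j
      ∎
    where
    S₊ : ℕ
    S₊ = ℕ∑.∑ N (λ i → (j C suc i) * x ^ suc i)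
    pascal : ∀ i → (suc j C suc i) * x ^ suc i ≡ x * ((j C i) * x ^ i) + (j C suc i) * x ^ suc i
    pascal i = begin
      (suc j C suc i) * (x * x ^ i)                      ≡⟨ cong (_* (x * x ^ i)) (nCk+nC[k+1]≡[n+1]C[k+1] j i) ⟨
      ((j C i) + (j C suc i)) * (x * x ^ i)              ≡⟨ distrib (j C i) (j C suc i) x (x ^ i) ⟩
      x * ((j C i) * x ^ i) + (j C suc i) * (x * x ^ i)  ∎
      where
      distrib : ∀ a b y z → (a + b) * (y * z) ≡ y * (a * z) + b * (y * z)
      distrib = solve-∀
    rearrange : ∀ a b c → a + (b + c) ≡ (a + c) + b
    rearrange = solve-∀

  module _ {p} (p-prime : Prime p) where

    0<n<p⇒p∤n : ∀ {n} → 0 < n → n < p → ¬ p ∣ n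
    0<n<p⇒p∤n {suc n} _ n<p p∣n = ℕP.<⇒≱ n<p (∣⇒≤ p∣n)

    p∤1 : ¬ p ∣ 1
    p∤1 p∣1 = ¬prime[1] (≡.subst Prime (∣1⇒≡1 p∣1) p-prime)

    p∤m⇒p∤n⇒p∤m*n : ∀ {m n} → ¬ p ∣ m → ¬ p ∣ n → ¬ p ∣ m * n
    p∤m⇒p∤n⇒p∤m*n {m} {n} p∤m p∤n p∣mn with euclidsLemma m n p-prime p∣mn
    ... | inj₁ p∣m = p∤m p∣m
    ... | inj₂ p∣n = p∤n p∣n

    n<p⇒p∤n! : ∀ {n} → n < p → ¬ p ∣ n !
    n<p⇒p∤n! {zero}  _   = p∤1
    n<p⇒p∤n! {suc n} n<p = p∤m⇒p∤n⇒p∤m*n (0<n<p⇒p∤n (s≤s z≤n) n<p) (n<p⇒p∤n! (ℕP.<⇒≤ n<p))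

    p∣pCk : ∀ {k} → 0 < k → k < p → p ∣ (p C k)
    p∣pCk {suc k} _ k<p with euclidsLemma (suc k !) (p C suc k) p-prime p∣k!*pCk
      where
      p∣k!*pCk : p ∣ suc k ! * (p C suc k)
      p∣k!*pCk = divides ((p ∸ 1) P′ k) (begin
        suc k ! * (p C suc k)  ≡⟨ k!*nCk≡nP′k p (suc k) ⟩
        (p P′ suc k)           ≡⟨ nP′[1+k]≡n*[n∸1]P′k p k ⟩
        p * ((p ∸ 1) P′ k)     ≡⟨ ℕP.*-comm p ((p ∸ 1) P′ k) ⟩
        ((p ∸ 1) P′ k) * p     ∎)
    ... | inj₁ p∣k!  = ⊥-elim (n<p⇒p∤n! k<p p∣k!)
    ... | inj₂ p∣pCk = p∣pCk

  fermat-little : ∀ {p} → Prime p → ∀ d → ∃ λ z → d ^ p ≡ d + p * z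
  fermat-little {zero}  ()
  fermat-little {suc q} p-prime zero    = 0 , sym (ℕP.*-zeroʳ (suc q))
  fermat-little {suc q} p-prime (suc d) = step (fermat-little p-prime d) p∣middle
    where
    p : ℕ
    p = suc q
    middle : ℕ
    middle = ℕ∑.∑ q (λ i → (p C suc i) * d ^ suc i)
    p∣middle : p ∣ middle
    p∣middle = ℕ∑.∑-closed (p ∣_) (p ∣0) ∣m∣n⇒∣m+n q
                 (λ i i<q → ∣m⇒∣m*n (d ^ suc i) (p∣pCk p-prime (s≤s z≤n) (s≤s i<q)))
    step : ∃ (λ z → d ^ p ≡ d + p * z) → p ∣ middle → ∃ λ z → suc d ^ p ≡ suc d + p * z
    step (z , dᵖ≡d+pz) (divides w middle≡wp) = w + z , (begin
      suc d ^ p                                          ≡⟨ binomial-theorem p d (suc p) ℕP.≤-refl ⟨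
      ℕ∑.∑ p (λ i → (p C i) * d ^ i) + (p C p) * d ^ p   ≡⟨ cong₂ (λ s c → s + c * d ^ p) (ℕ∑.∑-suc q _) (nCn≡1 p) ⟩
      1 + middle + 1 * d ^ p                             ≡⟨ cong₂ (λ s t → 1 + s + 1 * t) middle≡wp dᵖ≡d+pz ⟩
      1 + w * p + 1 * (d + p * z)                        ≡⟨ rearrange w p d z ⟩
      suc d + p * (w + z)                                ∎)
      where
      rearrange : ∀ w p d z → 1 + w * p + 1 * (d + p * z) ≡ suc d + p * (w + z)
      rearrange = solve-∀

  fermat-little-unit : ∀ {p d} → Prime p → ¬ p ∣ d → ∃ λ e → d ^ (p ∸ 1) ≡ 1 + p * e
  fermat-little-unit {zero}  ()
  fermat-little-unit {suc q} {zero}      p-prime p∤d = ⊥-elim (p∤d (suc q ∣0))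
  fermat-little-unit {suc q} {d@(suc _)} p-prime p∤d = step (fermat-little p-prime d)
    where
    p : ℕ
    p = suc q
    step : ∃ (λ z → d ^ p ≡ d + p * z) → ∃ λ e → d ^ q ≡ 1 + p * e
    step (z , dᵖ≡d+pz) with euclidsLemma d (d ^ q ∸ 1) p-prime (divides z d[dᵠ∸1]≡zp)
      where
      d[dᵠ∸1]≡zp : d * (d ^ q ∸ 1) ≡ z * p
      d[dᵠ∸1]≡zp = begin
        d * (d ^ q ∸ 1)   ≡⟨ ℕP.*-distribˡ-∸ d (d ^ q) 1 ⟩
        d ^ p ∸ d * 1     ≡⟨ cong₂ _∸_ dᵖ≡d+pz (ℕP.*-identityʳ d) ⟩
        d + p * z ∸ d     ≡⟨ ℕP.m+n∸m≡n d (p * z) ⟩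
        p * z             ≡⟨ ℕP.*-comm p z ⟩
        z * p             ∎
    ... | inj₁ p∣d = ⊥-elim (p∤d p∣d)
    ... | inj₂ (divides e dᵠ∸1≡ep) = e , (begin
      d ^ q              ≡⟨ ℕP.m+[n∸m]≡n (ℕP.m^n>0 d q) ⟨
      1 + (d ^ q ∸ 1)    ≡⟨ cong (1 +_) dᵠ∸1≡ep ⟩
      1 + e * p          ≡⟨ cong (1 +_) (ℕP.*-comm e p) ⟩
      1 + p * e          ∎)

  record Factorisation (p n : ℕ) : Set where
    field
      exponent              : ℕ
      cofactor              : ℕ
      p∤cofactor            : ¬ p ∣ cofactor
      n≡p^exponent*cofactor : n ≡ p ^ exponent * cofactor

  LegendreFactorisation : ℕ → ℕ → Set
  LegendreFactorisation p i = Σ (Factorisation p (i !)) λ f → (p ∸ 1) * Factorisation.exponent f ≤ i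

  module _ {p} (p-prime : Prime p) where

    private
      instance
        p≢0 : ℕ.NonZero p
        p≢0 = prime⇒nonZero p-prime

      1+[p∸1]≡p : suc (p ∸ 1) ≡ p
      1+[p∸1]≡p = ℕP.m+[n∸m]≡n (ℕ.>-nonZero⁻¹ p)

    factorial-block : ∀ a b → b < p → ∃ λ W → ¬ p ∣ W × (a * p + b) ! ≡ p ^ a * a ! * W
    factorial-block zero    zero    _   = 1 , p∤1 p-prime , refl
    factorial-block (suc a) zero    _   with factorial-block a (p ∸ 1) (ℕP.≤-reflexive 1+[p∸1]≡p)
    ... | W , p∤W , block = W , p∤W , (begin
      (suc a * p + 0) !                          ≡⟨ cong _! previous ⟨
      suc (a * p + (p ∸ 1)) !                    ≡⟨ cong (suc (a * p + (p ∸ 1)) *_) block ⟩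
      suc (a * p + (p ∸ 1)) * (p ^ a * a ! * W)  ≡⟨ cong (_* (p ^ a * a ! * W)) previous ⟩
      (suc a * p + 0) * (p ^ a * a ! * W)        ≡⟨ rearrange (suc a) p (p ^ a) (a !) W ⟩
      p * p ^ a * (suc a * a !) * W              ∎)
      where
      previous : suc (a * p + (p ∸ 1)) ≡ suc a * p + 0
      previous = begin
        suc (a * p + (p ∸ 1))  ≡⟨ ℕP.+-suc (a * p) (p ∸ 1) ⟨
        a * p + suc (p ∸ 1)    ≡⟨ cong (a * p +_) 1+[p∸1]≡p ⟩
        a * p + p              ≡⟨ ℕP.+-comm (a * p) p ⟩
        suc a * p              ≡⟨ ℕP.+-identityʳ (suc a * p) ⟨
        suc a * p + 0          ∎
      rearrange : ∀ a p x f W → (a * p + 0) * (x * f * W) ≡ p * x * (a * f) * W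
      rearrange = solve-∀
    factorial-block a       (suc b) b<p with factorial-block a b (ℕP.<⇒≤ b<p)
    ... | W , p∤W , block = suc (a * p + b) * W , p∤m⇒p∤n⇒p∤m*n p-prime p∤next p∤W , (begin
      (a * p + suc b) !                    ≡⟨ cong _! (ℕP.+-suc (a * p) b) ⟩
      suc (a * p + b) * (a * p + b) !      ≡⟨ cong (suc (a * p + b) *_) block ⟩
      suc (a * p + b) * (p ^ a * a ! * W)  ≡⟨ x∙yz≈y∙xz (suc (a * p + b)) (p ^ a * a !) W ⟩
      p ^ a * a ! * (suc (a * p + b) * W)  ∎)
      where
      p∤next : ¬ p ∣ suc (a * p + b)
      p∤next p∣next = 0<n<p⇒p∤n p-prime (s≤s z≤n) b<p
        (∣m+n∣m⇒∣n (≡.subst (p ∣_) (sym (ℕP.+-suc (a * p) b)) p∣next) (n∣m*n a))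

    factorial-factorisation : ∀ i → LegendreFactorisation p i
    factorial-factorisation = <-rec (LegendreFactorisation p) step
      where
      step : ∀ i → (∀ {j} → j < i → LegendreFactorisation p j) → LegendreFactorisation p i
      step zero        _   = record { exponent = 0 ; cofactor = 1 ; p∤cofactor = p∤1 p-prime
                                    ; n≡p^exponent*cofactor = refl }
                           , ℕP.≤-reflexive (ℕP.*-zeroʳ (p ∸ 1))
      step i@(suc _) rec = combine (factorial-block a b (m%n<n i p))
                                   (rec (m/n<m i p (ℕ.nonTrivial⇒n>1 p {{prime⇒nonTrivial p-prime}})))
        where
        a : ℕ
        a = i / p
        b : ℕ
        b = i % p
        i≡ap+b : i ≡ a * p + b
        i≡ap+b = trans (m≡m%n+[m/n]*n i p) (ℕP.+-comm b (a * p))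
        combine : (∃ λ W → ¬ p ∣ W × (a * p + b) ! ≡ p ^ a * a ! * W) → LegendreFactorisation p a →
                  LegendreFactorisation p i
        combine (W , p∤W , block) (fa , bound) =
          record { exponent = a + E ; cofactor = U * W ; p∤cofactor = p∤m⇒p∤n⇒p∤m*n p-prime p∤U p∤W
                 ; n≡p^exponent*cofactor = i!≡ }
          , ≡.subst ((p ∸ 1) * (a + E) ≤_) (trans (cong (λ x → a * x + b) 1+[p∸1]≡p) (sym i≡ap+b))
                    (n*E≤a⇒n*[a+E]≤a*[1+n]+b b bound)
          where
          open Factorisation fa
            renaming (exponent to E; cofactor to U; p∤cofactor to p∤U; n≡p^exponent*cofactor to a!≡pᴱU)
          i!≡ : i ! ≡ p ^ (a + E) * (U * W)
          i!≡ = begin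
            i !                      ≡⟨ cong _! i≡ap+b ⟩
            (a * p + b) !            ≡⟨ block ⟩
            p ^ a * a ! * W          ≡⟨ cong (λ x → p ^ a * x * W) a!≡pᴱU ⟩
            p ^ a * (p ^ E * U) * W  ≡⟨ reassoc (p ^ a) (p ^ E) U W ⟩
            p ^ a * p ^ E * (U * W)  ≡⟨ cong (_* (U * W)) (ℕP.^-distribˡ-+-* p a E) ⟨
            p ^ (a + E) * (U * W)    ∎
            where
            reassoc : ∀ x y u w → x * (y * u) * w ≡ x * y * (u * w)
            reassoc = solve-∀

  module _ (c q : ℕ) where

    forwardDifference : List ℕ → ℕ → ℕ
    forwardDifference xs i = sum (map (λ d → d ^ c * (d ^ q ∸ 1) ^ i) xs)

    newton-forward-difference : ∀ {xs} → All (1 ≤_) xs → ∀ j N → j < N →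
      ℕ∑.∑ N (λ i → forwardDifference xs i * (j C i)) ≡ sum (map (λ d → d ^ (c + q * j)) xs)
    newton-forward-difference []                      j N j<N = ℕ∑.∑-zero N (λ _ _ → refl)
    newton-forward-difference {d ∷ ds} (1≤d ∷ 1≤ds) j N j<N = begin
      ℕ∑.∑ N (λ i → (g i + forwardDifference ds i) * (j C i))
        ≡⟨ ℕ∑.∑-cong N (λ i _ → ℕP.*-distribʳ-+ (j C i) (g i) (forwardDifference ds i)) ⟩
      ℕ∑.∑ N (λ i → g i * (j C i) + forwardDifference ds i * (j C i))
        ≡⟨ ℕ∑.∑-+ N _ _ ⟩
      ℕ∑.∑ N (λ i → g i * (j C i)) + ℕ∑.∑ N (λ i → forwardDifference ds i * (j C i))
        ≡⟨ cong₂ _+_ single (newton-forward-difference 1≤ds j N j<N) ⟩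
      d ^ (c + q * j) + sum (map (λ d → d ^ (c + q * j)) ds) ∎
      where
      instance
        d≢0 : ℕ.NonZero d
        d≢0 = ℕ.>-nonZero 1≤d
      g : ℕ → ℕ
      g i = d ^ c * (d ^ q ∸ 1) ^ i
      single : ℕ∑.∑ N (λ i → g i * (j C i)) ≡ d ^ (c + q * j)
      single = begin
        ℕ∑.∑ N (λ i → d ^ c * (d ^ q ∸ 1) ^ i * (j C i))    ≡⟨ ℕ∑.∑-cong N (λ i _ → reorder (d ^ c) _ (j C i)) ⟩
        ℕ∑.∑ N (λ i → d ^ c * ((j C i) * (d ^ q ∸ 1) ^ i))  ≡⟨ ℕ∑.∑-*ˡ N (d ^ c) _ ⟨
        d ^ c * ℕ∑.∑ N (λ i → (j C i) * (d ^ q ∸ 1) ^ i)    ≡⟨ cong (d ^ c *_) (binomial-theorem j (d ^ q ∸ 1) N j<N) ⟩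
        d ^ c * suc (d ^ q ∸ 1) ^ j                         ≡⟨ cong (λ y → d ^ c * y ^ j) (ℕP.m+[n∸m]≡n (ℕP.m^n>0 d q)) ⟩
        d ^ c * (d ^ q) ^ j                                 ≡⟨ cong (d ^ c *_) (ℕP.^-*-assoc d q j) ⟩
        d ^ c * d ^ (q * j)                                 ≡⟨ ℕP.^-distribˡ-+-* d c (q * j) ⟨
        d ^ (c + q * j)                                     ∎
        where
        reorder : ∀ a b e → a * b * e ≡ a * (e * b)
        reorder = solve-∀

    forwardDifference-divisible : Prime (suc q) → ∀ {xs} → All (λ d → ¬ suc q ∣ d) xs →
                                  ∀ i → suc q ^ i ∣ forwardDifference xs i
    forwardDifference-divisible p-prime []           i = _ ∣0
    forwardDifference-divisible p-prime (p∤d ∷ p∤ds) i =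
      ∣m∣n⇒∣m+n (single (fermat-little-unit p-prime p∤d)) (forwardDifference-divisible p-prime p∤ds i)
      where
      single : ∀ {d} → (∃ λ e → d ^ q ≡ 1 + suc q * e) → suc q ^ i ∣ d ^ c * (d ^ q ∸ 1) ^ i
      single {d} (e , dᵠ≡1+pe) = ∣n⇒∣m*n (d ^ c) (≡.subst (λ y → suc q ^ i ∣ (y ∸ 1) ^ i) (sym dᵠ≡1+pe)
        (m∣n⇒m^k∣n^k i (divides e (ℕP.*-comm (suc q) e))))

-- p-adic quotients and Newton series

module _ where
  open import Data.Integer using (+_; -_; _+_; _-_; _*_; _^_; _⊖_; 0ℤ; 1ℤ)
  open import Data.Integer.Divisibility.Signed
    using ( _∣_; divides; ∣-refl; *-monoʳ-∣; *-monoˡ-∣; ∣m∣n⇒∣m+n; ∣m⇒∣m*n; ∣n⇒∣m*n; ∣m⇒∣-m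
          ; ∣m∣n⇒∣m-n; ∣-trans; ∣ᵤ⇒∣; ∣⇒∣ᵤ)
  open import Data.Integer.Tactic.RingSolver using (solve-∀)
  open import Data.Nat.Tactic.RingSolver renaming (solve-∀ to ℕ-solve-∀)
  open import Data.Nat.Combinatorics using (_C_)
  open import Data.Nat.Combinatorics.Base using (_P′_)
  open ≡.≡-Reasoning

  pos-^ : ∀ m n → + (m ℕ.^ n) ≡ (+ m) ^ n
  pos-^ m zero    = refl
  pos-^ m (suc n) = trans (ℤP.pos-* m (m ℕ.^ n)) (cong (+ m *_) (pos-^ m n))

  i∣0 : ∀ {i} → i ∣ 0ℤ
  i∣0 {i} = divides 0ℤ (sym (ℤP.*-zeroˡ i))

  ∑-∣ : ∀ {i} N {f} → (∀ t → t < N → i ∣ f t) → i ∣ ℤ∑.∑ N f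
  ∑-∣ {i} = ℤ∑.∑-closed (i ∣_) i∣0 ∣m∣n⇒∣m+n

  i∣j⇒i^k∣j^k : ∀ {i j} k → i ∣ j → i ^ k ∣ j ^ k
  i∣j⇒i^k∣j^k zero    i∣j = ∣-refl
  i∣j⇒i^k∣j^k {i} {j} (suc k) i∣j = ∣-trans (*-monoʳ-∣ i (i∣j⇒i^k∣j^k k i∣j)) (*-monoˡ-∣ (j ^ k) i∣j)

  pos-∣ : ∀ {a b} → a ℕ.∣ b → + a ∣ + b
  pos-∣ = ∣ᵤ⇒∣

  pos-∑ : ∀ N f → + ℕ∑.∑ N f ≡ ℤ∑.∑ N (λ i → + f i)
  pos-∑ zero    f = refl
  pos-∑ (suc N) f = trans (ℤP.pos-+ (ℕ∑.∑ N f) (f N)) (cong (_+ + f N) (pos-∑ N f))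

  ∑-sub : ∀ N f g → ℤ∑.∑ N (λ i → f i - g i) ≡ ℤ∑.∑ N f - ℤ∑.∑ N g
  ∑-sub zero    f g = refl
  ∑-sub (suc N) f g = trans (cong (_+ (f N - g N)) (∑-sub N f g)) (interchange (ℤ∑.∑ N f) (ℤ∑.∑ N g) (f N) (g N))
    where
    interchange : ∀ a b c d → (a - b) + (c - d) ≡ (a + c) - (b + d)
    interchange = solve-∀

  coherent-∣ : ∀ {p} (x : ℤ[ p ]) n → + (p ℕ.^ n) ∣ approx x (suc n) - approx x n
  coherent-∣ x n = ∣ᵤ⇒∣ (coherent x n)

  vp≥⇒∣ : ∀ {p} (x : ℤ[ p ]) {t} → vp≥ x t → ∀ n → + (p ℕ.^ (n ℕ.⊓ t)) ∣ approx x n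
  vp≥⇒∣ x x≥t n = ∣ᵤ⇒∣ (x≥t n)

  geometric-sum : ∀ x n → (1ℤ - x) * ℤ∑.∑ n (x ^_) ≡ 1ℤ - x ^ n
  geometric-sum x zero    = ℤP.*-zeroʳ (1ℤ - x)
  geometric-sum x (suc n) = begin
    (1ℤ - x) * (ℤ∑.∑ n (x ^_) + x ^ n)          ≡⟨ ℤP.*-distribˡ-+ (1ℤ - x) _ (x ^ n) ⟩
    (1ℤ - x) * ℤ∑.∑ n (x ^_) + (1ℤ - x) * x ^ n ≡⟨ cong (_+ (1ℤ - x) * x ^ n) (geometric-sum x n) ⟩
    (1ℤ - x ^ n) + (1ℤ - x) * x ^ n             ≡⟨ telescope x (x ^ n) ⟩
    1ℤ - x * x ^ n                              ∎
    where
    telescope : ∀ x y → (1ℤ - y) + (1ℤ - x) * y ≡ 1ℤ - x * y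
    telescope = solve-∀

  unit-inverse : ∀ {p u} → Prime p → ¬ p ℕ.∣ u → Σ ℤ[ p ] λ v → ∀ n → + (p ℕ.^ n) ∣ + u * approx v n - 1ℤ
  unit-inverse {p@(suc (suc r))} {u} p-prime p∤u = from-fermat (fermat-little-unit p-prime p∤u)
    where
    from-fermat : ∃ (λ e → u ℕ.^ suc r ≡ 1 ℕ.+ p ℕ.* e) → Σ ℤ[ p ] λ v → ∀ n → + (p ℕ.^ n) ∣ + u * approx v n - 1ℤ
    from-fermat (e , uᵖ⁻¹≡1+pe) = v , u*v≡1
      where
      x : ℤ
      x = - + (p ℕ.* e)
      pⁿ∣xⁿ : ∀ n → + (p ℕ.^ n) ∣ x ^ n
      pⁿ∣xⁿ n = ≡.subst (_∣ x ^ n) (sym (pos-^ p n)) (i∣j⇒i^k∣j^k n (divides (- + e) (begin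
        - + (p ℕ.* e)      ≡⟨ cong -_ (ℤP.pos-* p e) ⟩
        - (+ p * + e)      ≡⟨ cong -_ (ℤP.*-comm (+ p) (+ e)) ⟩
        - (+ e * + p)      ≡⟨ ℤP.neg-distribˡ-* (+ e) (+ p) ⟩
        - + e * + p        ∎)))
      -- u * u^(p-2) = 1 - x, and the geometric series in x = -p e inverts 1 - x modulo p^n.
      v : ℤ[ p ]
      approx v n = + (u ℕ.^ r) * ℤ∑.∑ n (x ^_)
      coherent v n = ∣⇒∣ᵤ (≡.subst (+ (p ℕ.^ n) ∣_) (sym (step (+ (u ℕ.^ r)) (ℤ∑.∑ n (x ^_)) (x ^ n)))
                                  (∣n⇒∣m*n (+ (u ℕ.^ r)) (pⁿ∣xⁿ n)))
        where
        step : ∀ a s t → a * (s + t) - a * s ≡ a * t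
        step = solve-∀
      u*v≡1 : ∀ n → + (p ℕ.^ n) ∣ + u * approx v n - 1ℤ
      u*v≡1 n = ≡.subst (+ (p ℕ.^ n) ∣_) (sym eq) (∣m⇒∣-m (pⁿ∣xⁿ n))
        where
        eq : + u * (+ (u ℕ.^ r) * ℤ∑.∑ n (x ^_)) - 1ℤ ≡ - x ^ n
        eq = begin
          + u * (+ (u ℕ.^ r) * ℤ∑.∑ n (x ^_)) - 1ℤ  ≡⟨ cong (_- 1ℤ) (ℤP.*-assoc (+ u) _ _) ⟨
          + u * + (u ℕ.^ r) * ℤ∑.∑ n (x ^_) - 1ℤ    ≡⟨ cong (λ z → z * ℤ∑.∑ n (x ^_) - 1ℤ) (ℤP.pos-* u (u ℕ.^ r)) ⟨
          + (u ℕ.^ suc r) * ℤ∑.∑ n (x ^_) - 1ℤ      ≡⟨ cong (λ z → z * ℤ∑.∑ n (x ^_) - 1ℤ) 1+pe≡1-x ⟩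
          (1ℤ - x) * ℤ∑.∑ n (x ^_) - 1ℤ              ≡⟨ cong (_- 1ℤ) (geometric-sum x n) ⟩
          1ℤ - x ^ n - 1ℤ                            ≡⟨ cancel (x ^ n) ⟩
          - x ^ n                                    ∎
          where
          1+pe≡1-x : + (u ℕ.^ suc r) ≡ 1ℤ - x
          1+pe≡1-x = trans (cong +_ uᵖ⁻¹≡1+pe)
                       (trans (ℤP.pos-+ 1 (p ℕ.* e)) (cong (λ z → 1ℤ + z) (sym (ℤP.neg-involutive (+ (p ℕ.* e))))))
          cancel : ∀ y → 1ℤ - y - 1ℤ ≡ - y
          cancel = solve-∀

  p-adic-quotient : ∀ {p E V i D} → Prime p → ¬ p ℕ.∣ V → E ≤ i → p ℕ.^ i ℕ.∣ D →
    Σ ℤ[ p ] λ y → vp≥ y (i ℕ.∸ E) × (∀ n → + (p ℕ.^ n) ∣ approx y n * + (p ℕ.^ E ℕ.* V) - + D)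
  p-adic-quotient {p} {E} {V} {i} {D} p-prime p∤V E≤i (ℕ.divides D′ D≡D′pⁱ) with unit-inverse p-prime p∤V
  ... | v , V*v≡1 = y , valuation , y*N≡D
    where
    X : ℕ
    X = D′ ℕ.* p ℕ.^ (i ℕ.∸ E)
    D≡Xpᴱ : D ≡ X ℕ.* p ℕ.^ E
    D≡Xpᴱ = trans D≡D′pⁱ (trans (cong (λ k → D′ ℕ.* p ℕ.^ k) (sym (ℕP.m∸n+n≡m E≤i)))
             (trans (cong (D′ ℕ.*_) (ℕP.^-distribˡ-+-* p (i ℕ.∸ E) E)) (sym (ℕP.*-assoc D′ _ _))))
    y : ℤ[ p ]
    approx y n = + X * approx v n
    coherent y n = ∣⇒∣ᵤ (≡.subst (+ (p ℕ.^ n) ∣_) (distrib (+ X) (approx v (suc n)) (approx v n))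
                                (∣n⇒∣m*n (+ X) (coherent-∣ v n)))
      where
      distrib : ∀ x a b → x * (a - b) ≡ x * a - x * b
      distrib = solve-∀
    valuation : vp≥ y (i ℕ.∸ E)
    valuation n = ∣⇒∣ᵤ (∣m⇒∣m*n (approx v n)
                     (pos-∣ (ℕ.∣-trans (^-monoʳ-∣ p (ℕP.m⊓n≤n n (i ℕ.∸ E))) (ℕ.n∣m*n D′))))
    y*N≡D : ∀ n → + (p ℕ.^ n) ∣ approx y n * + (p ℕ.^ E ℕ.* V) - + D
    y*N≡D n = ≡.subst (+ (p ℕ.^ n) ∣_) (sym eq) (∣n⇒∣m*n (+ X * + (p ℕ.^ E)) (V*v≡1 n))
      where
      eq : + X * approx v n * + (p ℕ.^ E ℕ.* V) - + D ≡ + X * + (p ℕ.^ E) * (+ V * approx v n - 1ℤ)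
      eq = begin
        + X * approx v n * + (p ℕ.^ E ℕ.* V) - + D
          ≡⟨ cong₂ (λ a b → + X * approx v n * a - b) (ℤP.pos-* (p ℕ.^ E) V) (trans (cong +_ D≡Xpᴱ) (ℤP.pos-* X (p ℕ.^ E))) ⟩
        + X * approx v n * (+ (p ℕ.^ E) * + V) - + X * + (p ℕ.^ E)
          ≡⟨ factor (+ X) (approx v n) (+ (p ℕ.^ E)) (+ V) ⟩
        + X * + (p ℕ.^ E) * (+ V * approx v n - 1ℤ)
          ∎
        where
        factor : ∀ x a q w → x * a * (q * w) - x * q ≡ x * q * (w * a - 1ℤ)
        factor = solve-∀

  newtonBasis : (ℕ → ℤ) → ℕ → ℤ → ℤ
  newtonBasis ℓ zero    x = 1ℤ
  newtonBasis ℓ (suc i) x = newtonBasis ℓ i x * (x - ℓ i)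

  shift : (ℕ → ℤ) → ℕ → ℤ
  shift c zero    = 0ℤ
  shift c (suc m) = c m

  newtonBasisCoeff : (ℕ → ℤ) → ℕ → ℕ → ℤ
  newtonBasisCoeff ℓ zero    zero    = 1ℤ
  newtonBasisCoeff ℓ zero    (suc m) = 0ℤ
  newtonBasisCoeff ℓ (suc i) m       = shift (newtonBasisCoeff ℓ i) m - ℓ i * newtonBasisCoeff ℓ i m

  newtonBasisCoeff-vanish : ∀ ℓ {i m} → i < m → newtonBasisCoeff ℓ i m ≡ 0ℤ
  newtonBasisCoeff-vanish ℓ {zero}  {suc m} _         = refl
  newtonBasisCoeff-vanish ℓ {suc i} {suc m} (s≤s i<m) = begin
    newtonBasisCoeff ℓ i m - ℓ i * newtonBasisCoeff ℓ i (suc m)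
      ≡⟨ cong₂ (λ a b → a - ℓ i * b) (newtonBasisCoeff-vanish ℓ i<m) (newtonBasisCoeff-vanish ℓ (ℕP.m<n⇒m<1+n i<m)) ⟩
    0ℤ - ℓ i * 0ℤ
      ≡⟨ cong (λ z → 0ℤ - z) (ℤP.*-zeroʳ (ℓ i)) ⟩
    0ℤ ∎

  ∑-shift : ∀ M c x → ℤ∑.∑ (suc M) (λ m → shift c m * x ^ m) ≡ x * ℤ∑.∑ M (λ m → c m * x ^ m)
  ∑-shift M c x = begin
    ℤ∑.∑ (suc M) (λ m → shift c m * x ^ m)    ≡⟨ ℤ∑.∑-suc M _ ⟩
    0ℤ * 1ℤ + ℤ∑.∑ M (λ m → c m * (x * x ^ m)) ≡⟨ ℤP.+-identityˡ _ ⟩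
    ℤ∑.∑ M (λ m → c m * (x * x ^ m))           ≡⟨ ℤ∑.∑-cong M (λ m _ → x∙yz≈y∙xz (c m) x (x ^ m)) ⟩
    ℤ∑.∑ M (λ m → x * (c m * x ^ m))           ≡⟨ ℤ∑.∑-*ˡ M x _ ⟨
    x * ℤ∑.∑ M (λ m → c m * x ^ m)             ∎
    where open import Algebra.Properties.CommutativeSemigroup ℤP.*-commutativeSemigroup using (x∙yz≈y∙xz)

  newtonBasis-expansion : ∀ ℓ i x M → i < M → ℤ∑.∑ M (λ m → newtonBasisCoeff ℓ i m * x ^ m) ≡ newtonBasis ℓ i x
  newtonBasis-expansion ℓ zero    x (suc M) _ =
    trans (ℤ∑.∑-suc M _) (cong (λ z → 1ℤ + z) (ℤ∑.∑-zero M (λ m _ → ℤP.*-zeroˡ (x ^ suc m))))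
  newtonBasis-expansion ℓ (suc i) x (suc M) (s≤s i<M) = begin
    ℤ∑.∑ (suc M) (λ m → (shift c m - ℓ i * c m) * x ^ m)
      ≡⟨ ℤ∑.∑-cong (suc M) (λ m _ → distrib (shift c m) (ℓ i) (c m) (x ^ m)) ⟩
    ℤ∑.∑ (suc M) (λ m → shift c m * x ^ m - ℓ i * (c m * x ^ m))
      ≡⟨ ∑-sub (suc M) _ _ ⟩
    ℤ∑.∑ (suc M) (λ m → shift c m * x ^ m) - ℤ∑.∑ (suc M) (λ m → ℓ i * (c m * x ^ m))
      ≡⟨ cong₂ _-_ (∑-shift M c x) (sym (ℤ∑.∑-*ˡ (suc M) (ℓ i) _)) ⟩
    x * ℤ∑.∑ M (λ m → c m * x ^ m) - ℓ i * ℤ∑.∑ (suc M) (λ m → c m * x ^ m)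
      ≡⟨ cong₂ (λ a b → x * a - ℓ i * b) (newtonBasis-expansion ℓ i x M i<M)
               (newtonBasis-expansion ℓ i x (suc M) (ℕP.m<n⇒m<1+n i<M)) ⟩
    x * newtonBasis ℓ i x - ℓ i * newtonBasis ℓ i x
      ≡⟨ factor x (ℓ i) (newtonBasis ℓ i x) ⟩
    newtonBasis ℓ i x * (x - ℓ i) ∎
    where
    c : ℕ → ℤ
    c = newtonBasisCoeff ℓ i
    distrib : ∀ s l a y → (s - l * a) * y ≡ s * y - l * (a * y)
    distrib = solve-∀
    factor : ∀ x l b → x * b - l * b ≡ b * (x - l)
    factor = solve-∀

  partialSum≡∑ : ∀ {p} (a : ℕ → ℤ[ p ]) k n M → partialSum a k n M ≡ ℤ∑.∑ M (λ m → approx (a m) n * (+ k) ^ m)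
  partialSum≡∑ a k n zero    = refl
  partialSum≡∑ a k n (suc M) = cong₂ (λ s t → s + approx (a M) n * t) (partialSum≡∑ a k n M) (pos-^ k M)

  module NewtonToPowerSeries {p} (ℓ : ℕ → ℤ) (y : ℕ → ℤ[ p ]) (w : ℕ → ℕ)
    (y-valuation : ∀ i → vp≥ (y i) (w i)) (w-large : ∀ {i n} → 2 ℕ.* n ≤ i → n ≤ w i) where

    private
      term : ℕ → ℕ → ℕ → ℤ
      term m n i = approx (y i) n * newtonBasisCoeff ℓ i m

    -- Modulo p^n the Newton terms with i ≥ 2n vanish (by w-large), so they are dropped at level n.
    coefficient : ℕ → ℤ[ p ]
    approx   (coefficient m) n = ℤ∑.∑ (2 ℕ.* n) (term m n)
    coherent (coefficient m) n = ∣⇒∣ᵤ (≡.subst (+ (p ℕ.^ n) ∣_) (sym split)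
      (∣m∣n⇒∣m+n (∣m∣n⇒∣m+n (∑-∣ (2 ℕ.* n) (λ i _ → step i))
                               (high ℕP.≤-refl)) (high (ℕP.n≤1+n _))))
      where
      T : ℕ
      T = 2 ℕ.* n
      split : ℤ∑.∑ (2 ℕ.* suc n) (term m (suc n)) - ℤ∑.∑ T (term m n)
            ≡ ℤ∑.∑ T (λ i → term m (suc n) i - term m n i) + term m (suc n) T + term m (suc n) (suc T)
      split = begin
        ℤ∑.∑ (2 ℕ.* suc n) (term m (suc n)) - ℤ∑.∑ T (term m n)
          ≡⟨ cong (λ N → ℤ∑.∑ N (term m (suc n)) - ℤ∑.∑ T (term m n)) (ℕP.*-suc 2 n) ⟩
        ℤ∑.∑ T (term m (suc n)) + term m (suc n) T + term m (suc n) (suc T) - ℤ∑.∑ T (term m n)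
          ≡⟨ reorder (ℤ∑.∑ T (term m (suc n))) _ _ _ ⟩
        ℤ∑.∑ T (term m (suc n)) - ℤ∑.∑ T (term m n) + term m (suc n) T + term m (suc n) (suc T)
          ≡⟨ cong (λ z → z + term m (suc n) T + term m (suc n) (suc T)) (∑-sub T _ _) ⟨
        ℤ∑.∑ T (λ i → term m (suc n) i - term m n i) + term m (suc n) T + term m (suc n) (suc T) ∎
        where
        reorder : ∀ a b c d → a + b + c - d ≡ a - d + b + c
        reorder = solve-∀
      step : ∀ i → + (p ℕ.^ n) ∣ term m (suc n) i - term m n i
      step i = ≡.subst (+ (p ℕ.^ n) ∣_) (distrib (approx (y i) (suc n)) (approx (y i) n) (newtonBasisCoeff ℓ i m))
        (∣m⇒∣m*n (newtonBasisCoeff ℓ i m) (coherent-∣ (y i) n))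
        where
        distrib : ∀ a b c → (a - b) * c ≡ a * c - b * c
        distrib = solve-∀
      high : ∀ {i} → T ≤ i → + (p ℕ.^ n) ∣ term m (suc n) i
      high {i} T≤i = ∣m⇒∣m*n (newtonBasisCoeff ℓ i m)
        (∣-trans (pos-∣ (^-monoʳ-∣ p (ℕP.⊓-glb (ℕP.n≤1+n n) (w-large T≤i)))) (vp≥⇒∣ (y i) (y-valuation i) (suc n)))

    coefficient-valuation : ∀ m {t} → (∀ {i} → m ≤ i → t ≤ w i) → vp≥ (coefficient m) t
    coefficient-valuation m {t} t≤w n = ∣⇒∣ᵤ (∑-∣ (2 ℕ.* n) (λ i _ → term-∣ i))
      where
      term-∣ : ∀ i → + (p ℕ.^ (n ℕ.⊓ t)) ∣ term m n i
      term-∣ i with m ℕP.≤? i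
      ... | yes m≤i = ∣m⇒∣m*n (newtonBasisCoeff ℓ i m)
                        (∣-trans (pos-∣ (^-monoʳ-∣ p (ℕP.⊓-monoʳ-≤ n (t≤w m≤i)))) (vp≥⇒∣ (y i) (y-valuation i) n))
      ... | no  m≰i = ≡.subst (_ ∣_) (sym (trans (cong (approx (y i) n *_) (newtonBasisCoeff-vanish ℓ (ℕP.≰⇒> m≰i)))
                                              (ℤP.*-zeroʳ (approx (y i) n)))) i∣0

    partialSum-coefficient : ∀ k n M → 2 ℕ.* n ≤ M →
      partialSum coefficient k n M ≡ ℤ∑.∑ (2 ℕ.* n) (λ i → approx (y i) n * newtonBasis ℓ i (+ k))
    partialSum-coefficient k n M 2n≤M = begin
      partialSum coefficient k n M
        ≡⟨ partialSum≡∑ coefficient k n M ⟩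
      ℤ∑.∑ M (λ m → ℤ∑.∑ T (term m n) * x ^ m)
        ≡⟨ ℤ∑.∑-cong M (λ m _ → ℤ∑.∑-*ʳ T (x ^ m) (term m n)) ⟩
      ℤ∑.∑ M (λ m → ℤ∑.∑ T (λ i → term m n i * x ^ m))
        ≡⟨ ℤ∑.∑-cong M (λ m _ → ℤ∑.∑-cong T (λ i _ → ℤP.*-assoc (approx (y i) n) _ _)) ⟩
      ℤ∑.∑ M (λ m → ℤ∑.∑ T (λ i → approx (y i) n * (newtonBasisCoeff ℓ i m * x ^ m)))
        ≡⟨ ℤ∑.∑-comm M T (λ i m → approx (y i) n * (newtonBasisCoeff ℓ i m * x ^ m)) ⟩
      ℤ∑.∑ T (λ i → ℤ∑.∑ M (λ m → approx (y i) n * (newtonBasisCoeff ℓ i m * x ^ m)))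
        ≡⟨ ℤ∑.∑-cong T (λ i _ → ℤ∑.∑-*ˡ M (approx (y i) n) _) ⟨
      ℤ∑.∑ T (λ i → approx (y i) n * ℤ∑.∑ M (λ m → newtonBasisCoeff ℓ i m * x ^ m))
        ≡⟨ ℤ∑.∑-cong T (λ i i<T → cong (approx (y i) n *_) (newtonBasis-expansion ℓ i x M (ℕP.<-≤-trans i<T 2n≤M))) ⟩
      ℤ∑.∑ T (λ i → approx (y i) n * newtonBasis ℓ i x) ∎
      where
      T : ℕ
      T = 2 ℕ.* n
      x : ℤ
      x = + k

  newtonBasis-progression : ∀ L q j i →
    newtonBasis (λ t → + (L ℕ.+ q ℕ.* t)) i (+ (L ℕ.+ q ℕ.* j)) ≡ + (q ℕ.^ i ℕ.* (j P′ i))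
  newtonBasis-progression L q j zero    = refl
  newtonBasis-progression L q j (suc i) with i ℕP.≤? j
  ... | yes i≤j = begin
    newtonBasis ℓ i k * (k - ℓ i)                       ≡⟨ cong₂ _*_ (newtonBasis-progression L q j i) k-ℓᵢ≡q[j∸i] ⟩
    + (q ℕ.^ i ℕ.* (j P′ i)) * + (q ℕ.* (j ℕ.∸ i))       ≡⟨ ℤP.pos-* (q ℕ.^ i ℕ.* (j P′ i)) _ ⟨
    + (q ℕ.^ i ℕ.* (j P′ i) ℕ.* (q ℕ.* (j ℕ.∸ i)))       ≡⟨ cong +_ (reorder (q ℕ.^ i) (j P′ i) q (j ℕ.∸ i)) ⟩
    + (q ℕ.* q ℕ.^ i ℕ.* ((j ℕ.∸ i) ℕ.* (j P′ i)))       ∎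
    where
    ℓ : ℕ → ℤ
    ℓ t = + (L ℕ.+ q ℕ.* t)
    k : ℤ
    k = + (L ℕ.+ q ℕ.* j)
    k-ℓᵢ≡q[j∸i] : k - ℓ i ≡ + (q ℕ.* (j ℕ.∸ i))
    k-ℓᵢ≡q[j∸i] = begin
      k - ℓ i                                       ≡⟨ ℤP.m-n≡m⊖n (L ℕ.+ q ℕ.* j) (L ℕ.+ q ℕ.* i) ⟩
      (L ℕ.+ q ℕ.* j) ⊖ (L ℕ.+ q ℕ.* i)             ≡⟨ ℤP.⊖-≥ (ℕP.+-monoʳ-≤ L (ℕP.*-monoʳ-≤ q i≤j)) ⟩
      + ((L ℕ.+ q ℕ.* j) ℕ.∸ (L ℕ.+ q ℕ.* i))       ≡⟨ cong +_ (ℕP.[m+n]∸[m+o]≡n∸o L (q ℕ.* j) (q ℕ.* i)) ⟩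
      + (q ℕ.* j ℕ.∸ q ℕ.* i)                       ≡⟨ cong +_ (ℕP.*-distribˡ-∸ q j i) ⟨
      + (q ℕ.* (j ℕ.∸ i))                           ∎
    reorder : ∀ a b c d → a ℕ.* b ℕ.* (c ℕ.* d) ≡ c ℕ.* a ℕ.* (d ℕ.* b)
    reorder = ℕ-solve-∀
  ... | no  i≰j
    rewrite newtonBasis-progression L q j i | n<k⇒nP′k≡0 (ℕP.≰⇒> i≰j)
          | ℕP.*-zeroʳ (q ℕ.^ i) | ℕP.*-zeroʳ (j ℕ.∸ i) | ℕP.*-zeroʳ (q ℕ.* q ℕ.^ i) = refl

  module DivisorSumExpansion {q} (p-prime : Prime (suc q)) (2≤q : 2 ≤ q) (L : ℕ) (1≤L : 1 ≤ L)
    {xs : List ℕ} (p∤xs : All (λ d → ¬ suc q ℕ.∣ d) xs) where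

    private
      instance
        q≢0 : ℕ.NonZero q
        q≢0 = ℕ.>-nonZero (ℕP.<-≤-trans (s≤s z≤n) 2≤q)

      p : ℕ
      p = suc q

      D : ℕ → ℕ
      D = forwardDifference (L ℕ.∸ 1) q xs

      E : ℕ → ℕ
      E i = Factorisation.exponent (proj₁ (factorial-factorisation p-prime i))

      U : ℕ → ℕ
      U i = Factorisation.cofactor (proj₁ (factorial-factorisation p-prime i))

      q*E≤i : ∀ i → q ℕ.* E i ≤ i
      q*E≤i i = proj₂ (factorial-factorisation p-prime i)

      i!*qⁱ≡pᴱ*Uqⁱ : ∀ i → i ℕ.! ℕ.* q ℕ.^ i ≡ p ℕ.^ E i ℕ.* (U i ℕ.* q ℕ.^ i)
      i!*qⁱ≡pᴱ*Uqⁱ i = trans (cong (ℕ._* q ℕ.^ i) (Factorisation.n≡p^exponent*cofactor (proj₁ (factorial-factorisation p-prime i))))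
                              (ℕP.*-assoc (p ℕ.^ E i) (U i) (q ℕ.^ i))

      p∤Uqⁱ : ∀ i → ¬ p ℕ.∣ U i ℕ.* q ℕ.^ i
      p∤Uqⁱ i = p∤m⇒p∤n⇒p∤m*n p-prime (Factorisation.p∤cofactor (proj₁ (factorial-factorisation p-prime i))) (p∤qⁱ i)
        where
        p∤qⁱ : ∀ i → ¬ p ℕ.∣ q ℕ.^ i
        p∤qⁱ zero    = p∤1 p-prime
        p∤qⁱ (suc i) = p∤m⇒p∤n⇒p∤m*n p-prime (0<n<p⇒p∤n p-prime (ℕ.>-nonZero⁻¹ q) ℕP.≤-refl) (p∤qⁱ i)

      quotient : ∀ i → Σ ℤ[ p ] λ y → vp≥ y (i ℕ.∸ E i)
                                    × (∀ n → + (p ℕ.^ n) ∣ approx y n * + (p ℕ.^ E i ℕ.* (U i ℕ.* q ℕ.^ i)) - + D i)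
      quotient i = p-adic-quotient p-prime (p∤Uqⁱ i) (ℕP.≤-trans (ℕP.m≤n*m (E i) q) (q*E≤i i))
                     (forwardDifference-divisible (L ℕ.∸ 1) q p-prime p∤xs i)

      y : ℕ → ℤ[ p ]
      y i = proj₁ (quotient i)

      y-valuation : ∀ i → vp≥ (y i) (i ℕ.∸ E i)
      y-valuation i = proj₁ (proj₂ (quotient i))

      y*i!qⁱ≈D : ∀ i n → + (p ℕ.^ n) ∣ approx (y i) n * + (p ℕ.^ E i ℕ.* (U i ℕ.* q ℕ.^ i)) - + D i
      y*i!qⁱ≈D i = proj₂ (proj₂ (quotient i))

      ℓ : ℕ → ℤ
      ℓ t = + (L ℕ.+ q ℕ.* t)

      module Series = NewtonToPowerSeries ℓ y (λ i → i ℕ.∸ E i) y-valuation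
                        (λ {i} 2n≤i → 2≤n⇒n*E≤i⇒2*t≤i⇒t≤i∸E 2≤q (q*E≤i i) 2n≤i)
      open Series using (coefficient-valuation; partialSum-coefficient)

    open Series public using (coefficient)

    coefficient-bound : ∀ m → vp≥ (coefficient m) (m ℕ.∸ m ℕ./ q)
    coefficient-bound m = coefficient-valuation m (λ {i} m≤i → m≤i⇒n*E≤i⇒m∸m/n≤i∸E m≤i (q*E≤i i))

    convergence : ∀ j → SeriesConvergesTo coefficient (L ℕ.+ q ℕ.* j) (sum (map (λ d → d ℕ.^ (L ℕ.+ q ℕ.* j ℕ.∸ 1)) xs))
    convergence j n = T , λ M T≤M → ∣⇒∣ᵤ (≡.subst (+ (p ℕ.^ n) ∣_) (sym (difference M T≤M))
      (∣m∣n⇒∣m-n (∑-∣ T (λ i _ → term-∣ i)) (pos-∣ tail-∣)))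
      where
      T : ℕ
      T = 2 ℕ.* n
      k : ℕ
      k = L ℕ.+ q ℕ.* j
      F : ℕ → ℕ
      F i = D i ℕ.* (j C i)
      tail : ℕ
      tail = ℕ∑.∑ (suc j) (λ t → F (T ℕ.+ t))
      term : ℕ → ℤ
      term i = approx (y i) n * + (q ℕ.^ i ℕ.* (j P′ i)) - + F i

      term-∣ : ∀ i → + (p ℕ.^ n) ∣ term i
      term-∣ i = ≡.subst (+ (p ℕ.^ n) ∣_) (sym eq) (∣m⇒∣m*n (+ (j C i)) (y*i!qⁱ≈D i n))
        where
        N : ℕ
        N = p ℕ.^ E i ℕ.* (U i ℕ.* q ℕ.^ i)
        qⁱP′≡NC : q ℕ.^ i ℕ.* (j P′ i) ≡ N ℕ.* (j C i)
        qⁱP′≡NC = begin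
          q ℕ.^ i ℕ.* (j P′ i)              ≡⟨ cong (q ℕ.^ i ℕ.*_) (k!*nCk≡nP′k j i) ⟨
          q ℕ.^ i ℕ.* (i ℕ.! ℕ.* (j C i))   ≡⟨ x∙yz≈y∙xz (q ℕ.^ i) (i ℕ.!) (j C i) ⟩
          i ℕ.! ℕ.* (q ℕ.^ i ℕ.* (j C i))   ≡⟨ ℕP.*-assoc (i ℕ.!) (q ℕ.^ i) (j C i) ⟨
          i ℕ.! ℕ.* q ℕ.^ i ℕ.* (j C i)     ≡⟨ cong (ℕ._* (j C i)) (i!*qⁱ≡pᴱ*Uqⁱ i) ⟩
          N ℕ.* (j C i)                     ∎
          where open import Algebra.Properties.CommutativeSemigroup ℕP.*-commutativeSemigroup using (x∙yz≈y∙xz)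
        eq : term i ≡ (approx (y i) n * + N - + D i) * + (j C i)
        eq = begin
          approx (y i) n * + (q ℕ.^ i ℕ.* (j P′ i)) - + (D i ℕ.* (j C i))
            ≡⟨ cong₂ (λ a b → approx (y i) n * a - b) (trans (cong +_ qⁱP′≡NC) (ℤP.pos-* N (j C i))) (ℤP.pos-* (D i) (j C i)) ⟩
          approx (y i) n * (+ N * + (j C i)) - + D i * + (j C i)
            ≡⟨ factor (approx (y i) n) (+ N) (+ (j C i)) (+ D i) ⟩
          (approx (y i) n * + N - + D i) * + (j C i) ∎
          where
          factor : ∀ a b c e → a * (b * c) - e * c ≡ (a * b - e) * c
          factor = solve-∀

      tail-∣ : p ℕ.^ n ℕ.∣ tail
      tail-∣ = ℕ∑.∑-closed (p ℕ.^ n ℕ.∣_) (ℕ._∣0 _) ℕ.∣m∣n⇒∣m+n (suc j) (λ t _ →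
        ℕ.∣m⇒∣m*n (j C (T ℕ.+ t)) (ℕ.∣-trans (^-monoʳ-∣ p (ℕP.≤-trans (ℕP.m≤n*m n 2) (ℕP.m≤m+n T t)))
                                            (forwardDifference-divisible (L ℕ.∸ 1) q p-prime p∤xs (T ℕ.+ t))))

      target : + sum (map (λ d → d ℕ.^ (k ℕ.∸ 1)) xs) ≡ ℤ∑.∑ T (λ i → + F i) + + tail
      target = begin
        + sum (map (λ d → d ℕ.^ (k ℕ.∸ 1)) xs)             ≡⟨ cong (λ e → + sum (map (ℕ._^ e) xs)) (ℕP.+-∸-comm (q ℕ.* j) 1≤L) ⟩
        + sum (map (λ d → d ℕ.^ (L ℕ.∸ 1 ℕ.+ q ℕ.* j)) xs) ≡⟨ cong +_ newton ⟨
        + ℕ∑.∑ (T ℕ.+ suc j) F                             ≡⟨ cong +_ (ℕ∑.∑-+-split T (suc j) F) ⟩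
        + (ℕ∑.∑ T F ℕ.+ tail)                              ≡⟨ ℤP.pos-+ (ℕ∑.∑ T F) tail ⟩
        + ℕ∑.∑ T F + + tail                                ≡⟨ cong (_+ + tail) (pos-∑ T F) ⟩
        ℤ∑.∑ T (λ i → + F i) + + tail                      ∎
        where
        p∤d⇒1≤d : ∀ {d} → ¬ p ℕ.∣ d → 1 ≤ d
        p∤d⇒1≤d {zero}  p∤0 = ⊥-elim (p∤0 (p ℕ.∣0))
        p∤d⇒1≤d {suc d} _   = s≤s z≤n
        newton : ℕ∑.∑ (T ℕ.+ suc j) F ≡ sum (map (λ d → d ℕ.^ (L ℕ.∸ 1 ℕ.+ q ℕ.* j)) xs)
        newton = newton-forward-difference (L ℕ.∸ 1) q (All.map p∤d⇒1≤d p∤xs) j (T ℕ.+ suc j) (ℕP.m≤n+m (suc j) T)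

      difference : ∀ M → T ≤ M →
                   partialSum coefficient k n M - + sum (map (λ d → d ℕ.^ (k ℕ.∸ 1)) xs) ≡ ℤ∑.∑ T term - + tail
      difference M T≤M = begin
        partialSum coefficient k n M - + sum (map (λ d → d ℕ.^ (k ℕ.∸ 1)) xs)
          ≡⟨ cong₂ _-_ (partialSum-coefficient k n M T≤M) target ⟩
        ℤ∑.∑ T (λ i → approx (y i) n * newtonBasis ℓ i (+ k)) - (ℤ∑.∑ T (λ i → + F i) + + tail)
          ≡⟨ cong (_- (ℤ∑.∑ T (λ i → + F i) + + tail)) (ℤ∑.∑-cong T (λ i _ → cong (approx (y i) n *_) (newtonBasis-progression L q j i))) ⟩
        ℤ∑.∑ T (λ i → approx (y i) n * + (q ℕ.^ i ℕ.* (j P′ i))) - (ℤ∑.∑ T (λ i → + F i) + + tail)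
          ≡⟨ regroup (ℤ∑.∑ T (λ i → approx (y i) n * + (q ℕ.^ i ℕ.* (j P′ i)))) (ℤ∑.∑ T (λ i → + F i)) (+ tail) ⟩
        ℤ∑.∑ T (λ i → approx (y i) n * + (q ℕ.^ i ℕ.* (j P′ i))) - ℤ∑.∑ T (λ i → + F i) - + tail
          ≡⟨ cong (_- + tail) (∑-sub T _ _) ⟨
        ℤ∑.∑ T term - + tail ∎
        where
        regroup : ∀ a b t → a - (b + t) ≡ a - b - t
        regroup = solve-∀

-- Residue classes

open import Defs
open import Data.Nat using (ℕ; _∸_; _≤_; _<_; _+_)
open import Data.Nat.Primality using (Prime)
open import Data.Nat.Divisibility using (_∣_)
open import Data.Integer using (+_; _-_)
open import Data.Integer.Divisibility renaming (_∣_ to _∣ℤ_)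
open import Data.Product using (Σ; _×_)
open import Relation.Nullary using (¬_)

open import Data.Nat using (_*_)
open import Data.Nat.DivMod using (_/_; m<n⇒m/n≡0)
open import Data.List using (filter; applyUpTo)
open import Data.List.Relation.Unary.All.Properties using (all-filter)
open import Relation.Nullary using (¬?)
open import Relation.Nullary.Decidable using (_×-dec_)

coprimeDivisors : ℕ → ℕ → List ℕ
coprimeDivisors p r = filter (λ d → (d ℕ.∣? r) ×-dec ¬? (p ℕ.∣? d)) (applyUpTo suc r)

coprimeDivisors-coprime : ∀ p r → All (λ d → ¬ p ∣ d) (coprimeDivisors p r)
coprimeDivisors-coprime p r = All.map proj₂ (all-filter (λ d → (d ℕ.∣? r) ×-dec ¬? (p ℕ.∣? d)) (applyUpTo suc r))

-- Taking q instead of 0 for l = 0 keeps 1 ≤ L, so that k - 1 = (L - 1) + q j without truncation.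
leastPositiveResidue : ℕ → ℕ → ℕ
leastPositiveResidue q zero    = q
leastPositiveResidue q (suc l) = suc l

leastPositiveResidue-positive : ∀ {q} l → 1 ≤ q → 1 ≤ leastPositiveResidue q l
leastPositiveResidue-positive zero    1≤q = 1≤q
leastPositiveResidue-positive (suc l) _   = s≤s z≤n

residue-class : ∀ {q l k} → l < q → 0 < k → + q ∣ℤ + k - + l → ∃ λ j → k ≡ leastPositiveResidue q l + q * j
residue-class {q} {l} {k} l<q 0<k q∣k-l with l ℕP.≤? k
... | yes l≤k = from-difference l≤k (≡.subst (q ∣_) (trans (cong ℤ.∣_∣ (ℤP.m-n≡m⊖n k l))
                                         (trans (ℤP.∣m⊖n∣≡∣n⊖m∣ k l) (ℤP.∣⊖∣-≤ l≤k))) q∣k-l)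
  where
  from-difference : ∀ {l} → l ≤ k → q ∣ k ∸ l → ∃ λ j → k ≡ leastPositiveResidue q l + q * j
  from-difference {zero}  _   (ℕ.divides zero    k≡0)   = ⊥-elim (ℕP.<⇒≢ 0<k (sym k≡0))
  from-difference {zero}  _   (ℕ.divides (suc j) k≡jq)  = j , trans k≡jq (cong (λ n → q + n) (ℕP.*-comm j q))
  from-difference {suc l} l≤k (ℕ.divides j k∸l≡jq)      =
    j , trans (sym (ℕP.m+[n∸m]≡n l≤k)) (cong (λ n → suc l + n) (trans k∸l≡jq (ℕP.*-comm j q)))
... | no  l≰k = ⊥-elim (l∸k-too-small (≡.subst (q ∣_) (trans (cong ℤ.∣_∣ (ℤP.m-n≡m⊖n k l)) (ℤP.∣⊖∣-< k<l)) q∣k-l))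
  where
  k<l : k < l
  k<l = ℕP.≰⇒> l≰k
  l∸k-too-small : ¬ q ∣ l ∸ k
  l∸k-too-small q∣l∸k = ℕP.<⇒≱ (ℕP.≤-<-trans (ℕP.m∸n≤m l k) l<q) (ℕ.∣⇒≤ {{ℕ.>-nonZero (ℕP.m<n⇒0<n∸m k<l)}} q∣l∸k)

proposition3p3 : (p : ℕ) → Prime p → ¬ (2 ∣ p) →
    (l : ℕ) → l < p ∸ 1 → 2 ∣ l →
    (r : ℕ) → 1 ≤ r →
    Σ (ℕ → ℤ[ p ]) λ a →
      ((k : ℕ) → 2 ∣ k → 4 ≤ k → (+ (p ∸ 1)) ∣ℤ (+ k - + l) →
        SeriesConvergesTo a k (aG* p k r))
      × ((m : ℕ) → vp≥ (a m) (vbound p m))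
      × ((m : ℕ) → m + 2 ≤ p → vp≥ (a m) m)
proposition3p3 (suc (suc zero)) _ p-odd = ⊥-elim (p-odd ℕ.∣-refl)
proposition3p3 p@(suc (suc (suc q′))) p-prime _ l l<q _ r _ =
  coefficient , converges , coefficient-bound ,
  λ m m+2≤p → ≡.subst (vp≥ (coefficient m)) (m+2≤p⇒m∸m/q≡m m+2≤p) (coefficient-bound m)
  where
  q : ℕ
  q = suc (suc q′)
  open DivisorSumExpansion p-prime (s≤s (s≤s z≤n)) (leastPositiveResidue q l) (leastPositiveResidue-positive l (s≤s z≤n))
                           (coprimeDivisors-coprime p r)
  converges : (k : ℕ) → 2 ∣ k → 4 ≤ k → (+ (p ∸ 1)) ∣ℤ (+ k - + l) → SeriesConvergesTo coefficient k (aG* p k r)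
  converges k _ 4≤k q∣k-l = from-residue (residue-class l<q (ℕP.<-≤-trans (s≤s z≤n) 4≤k) q∣k-l)
    where
    from-residue : ∃ (λ j → k ≡ leastPositiveResidue q l + q * j) → SeriesConvergesTo coefficient k (aG* p k r)
    from-residue (j , refl) = convergence j
  m+2≤p⇒m∸m/q≡m : ∀ {m} → m + 2 ≤ p → m ∸ m / q ≡ m
  m+2≤p⇒m∸m/q≡m {m} m+2≤p = cong (m ∸_) (m<n⇒m/n≡0 (ℕP.≤-pred (≡.subst (_≤ p) (ℕP.+-comm m 2) m+2≤p)))
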